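{- Let $G$ be a connected proper interval graph and let $\sigma=(v_1,v_2,\ldots,v_n)$ be a bi-compatible elimination ordering of $G$. For $1\le i\le n$ let $G_i=G[\{v_i,v_{i+1},\ldots,v_n\}]$. Then: (a) if $k\le i$, then $N_G[v_k]\cap V(G_i)\subseteq N_{G_i}[v_i]$; (b) if $v_k\in N_{G_i}[v_i]$, then $N_{G_i}[v_i]\subseteq N_{G_i}[v_k]$.
   Context: A proper interval graph is the intersection graph of a finite family of intervals on the real line in which no interval properly contains another. $N_H[v]$ denotes the closed neighborhood of $v$ in a graph $H$. A vertex is simplicial if its closed neighborhood is a clique. An ordering $(v_1,\ldots,v_n)$ of the vertices of $G$ is a perfect elimination ordering if each $v_i$ is simplicial in $G[\{v_i,\ldots,v_n\}]$; it is a bi-compatible elimination ordering (BCO) if both it and its reverse $(v_n,\ldots,v_1)$ are perfect elimination orderings, i.e. each $v_i$ is simplicial in both $G[\{v_1,\ldots,v_i\}]$ and $G[\{v_i,\ldots,v_n\}]$. -}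

module Defs where

open import Level using (0ℓ)
open import Data.Nat using (ℕ)
open import Data.Fin using (Fin; _≤_)
open import Data.List using (List; []; _∷_)
open import Data.Product using (Σ; _×_; ∃; ∃-syntax)
open import Data.Sum using (_⊎_)
open import Data.Rational as ℚ using (ℚ)
open import Relation.Binary.PropositionalEquality using (_≡_)
open import Relation.Nullary using (¬_)
open import Function.Bundles using (_↔_; Inverse)

record Graph (n : ℕ) : Set₁ where
  field
    Adj   : Fin n → Fin n → Set
    sym   : ∀ {u v} → Adj u v → Adj v u
    irrefl : ∀ {v} → ¬ Adj v v
open Graph public

module _ {n : ℕ} (G : Graph n) where

  N[_] : Fin n → Fin n → Set
  N[ v ] w = (w ≡ v) ⊎ Adj G v w

  -- walk from u to v given by the list of intermediate-and-final vertices
  WalkFrom : Fin n → List (Fin n) → Fin n → Set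
  WalkFrom u [] v = u ≡ v
  WalkFrom u (w ∷ ws) v = Adj G u w × WalkFrom w ws v

  Connected : Set
  Connected = ∀ u v → ∃[ ws ] WalkFrom u ws v

  record ProperIntervalModel : Set where
    field
      left right : Fin n → ℚ
      wf : ∀ v → left v ℚ.≤ right v
      model : ∀ u v → ¬ (u ≡ v) →
        (Adj G u v → (left u ℚ.≤ right v × left v ℚ.≤ right u)) ×
        ((left u ℚ.≤ right v × left v ℚ.≤ right u) → Adj G u v)
      proper : ∀ u v → left u ℚ.≤ left v → right v ℚ.≤ right u →
        (left u ≡ left v × right u ≡ right v)

  ProperInterval : Set
  ProperInterval = ProperIntervalModel

  SimplicialIn : (Fin n → Set) → Fin n → Set
  SimplicialIn S v = ∀ a b → S a → S b → N[ v ] a → N[ v ] b → (a ≡ b) ⊎ Adj G a b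

  -- An ordering (v_1,…,v_n) is a bijection σ : positions → vertices, v_i = σ i.
  module _ (σ : Fin n ↔ Fin n) where
    private
      v : Fin n → Fin n
      v = Inverse.to σ
      pos : Fin n → Fin n
      pos = Inverse.from σ

    Suffix : Fin n → Fin n → Set
    Suffix i w = i ≤ pos w

    Prefix : Fin n → Fin n → Set
    Prefix i w = pos w ≤ i

    BCO : Set
    BCO = ∀ i → SimplicialIn (Prefix i) (v i) × SimplicialIn (Suffix i) (v i)

    NG_[_] : Fin n → Fin n → Fin n → Set
    NG i [ x ] w = Suffix i w × N[ x ] w

{-# OPTIONS --safe #-}
-- A walk in a graph with a bi-compatible ordering straightens to a monotone
-- path: where the walk turns, its two neighbours on the walk lie on the same
-- side of the turning vertex, where its neighbourhood is a clique, so the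
-- turning vertex can be skipped. Along an increasing path from v_k to v_i, an
-- edge v_k w with w after v_i is handed on step by step by the same clique
-- property, giving v_i w; this is (a). Part (b) is simpliciality of v_i in G_i.
module Submission where

open import Defs hiding (sym)
open import Level using (Level; 0ℓ)
open import Data.Nat using (ℕ)
open import Data.Nat.Properties using (m≤n⇒m<n∨m≡n; <⇒≤)
open import Data.Fin using (Fin; _≤_; _<_)
open import Data.Fin.Properties using (<-cmp; <-trans; <-irrefl; toℕ-injective)
open import Data.Product using (_×_; _,_; proj₁; proj₂)
open import Data.Sum using (_⊎_; inj₁; inj₂; swap)
open import Data.Empty using (⊥-elim)
open import Data.List using (_∷_; [])
open import Function using (flip; _∘_)
open import Function.Bundles using (_↔_; Inverse)
open import Relation.Binary.Core using (Rel)
open import Relation.Binary.Definitions using (Trichotomous; tri<; tri≈; tri>)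
open import Relation.Binary.Structures using (IsStrictTotalOrder)
import Relation.Binary.Construct.Flip.EqAndOrd as Flip
open import Relation.Binary.PropositionalEquality
  using (_≡_; refl; sym; cong; subst; subst₂; isEquivalence; resp₂; module ≡-Reasoning)

private
  variable
    ℓ : Level
    n : ℕ

simplicial⇒N[]-⊆ : (G : Graph n) {S : Fin n → Set} {v a b : Fin n} →
  SimplicialIn G S v → S a → S b → N[_] G v a → N[_] G v b → N[_] G a b
simplicial⇒N[]-⊆ G simplicial Sa Sb va vb with simplicial _ _ Sa Sb va vb
... | inj₁ refl = inj₁ refl
... | inj₂ ab   = inj₂ ab

module _ (G : Graph n) where

  PerfectEliminationOrder : Rel (Fin n) ℓ → Set ℓ
  PerfectEliminationOrder _≺_ =
    ∀ {x a b} → x ≺ a → x ≺ b → Adj G x a → Adj G x b → a ≡ b ⊎ Adj G a b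

  data IncreasingPath (_≺_ : Rel (Fin n) ℓ) : Fin n → Fin n → Set ℓ where
    []   : ∀ {x} → IncreasingPath _≺_ x x
    step : ∀ {x y z} → Adj G x y → x ≺ y → IncreasingPath _≺_ y z → IncreasingPath _≺_ x z

  module PerfectElimination {_≺_ : Rel (Fin n) ℓ}
    (≺-isStrictTotalOrder : IsStrictTotalOrder _≡_ _≺_)
    (peo : PerfectEliminationOrder _≺_) where

    open IsStrictTotalOrder ≺-isStrictTotalOrder
      using (compare) renaming (trans to ≺-trans; irrefl to ≺-irrefl)

    increasingPath⇒≡⊎≺ : ∀ {x z} → IncreasingPath _≺_ x z → x ≡ z ⊎ x ≺ z
    increasingPath⇒≡⊎≺ []                 = inj₁ refl
    increasingPath⇒≡⊎≺ (step _ x≺y path) with increasingPath⇒≡⊎≺ path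
    ... | inj₁ refl = inj₂ x≺y
    ... | inj₂ y≺z  = inj₂ (≺-trans x≺y y≺z)

    -- Going down from u to x and then up again, the later neighbours u and y
    -- of x are adjacent, which shortcuts x.
    increasingPath-prepend : ∀ {u x z} → Adj G u x → IncreasingPath _≺_ x z →
      IncreasingPath _≺_ u z ⊎ IncreasingPath (flip _≺_) u z
    increasingPath-prepend {u} {x} ux path with compare u x
    ... | tri< u≺x _ _ = inj₁ (step ux u≺x path)
    ... | tri≈ _ refl _ = ⊥-elim (irrefl G ux)
    ... | tri> _ _ x≺u with path
    ...   | []             = inj₂ (step ux x≺u [])
    ...   | step xy x≺y rest with peo x≺u x≺y (Graph.sym G ux) xy
    ...     | inj₁ refl = inj₁ rest
    ...     | inj₂ uy   = increasingPath-prepend uy rest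

    ≡⊎≺-≺-trans : ∀ {x y z} → x ≡ y ⊎ x ≺ y → y ≺ z → x ≺ z
    ≡⊎≺-≺-trans (inj₁ refl) y≺z = y≺z
    ≡⊎≺-≺-trans (inj₂ x≺y)  y≺z = ≺-trans x≺y y≺z

    increasingPath-umbrella : ∀ {x y z} → IncreasingPath _≺_ x y → y ≺ z →
      Adj G x z → Adj G y z
    increasingPath-umbrella []                            _   xz = xz
    increasingPath-umbrella (step {y = w} xw x≺w path) y≺z xz =
      shortcut (peo x≺w (≺-trans x≺w w≺z) xw xz)
      where
        w≺z : w ≺ _
        w≺z = ≡⊎≺-≺-trans (increasingPath⇒≡⊎≺ path) y≺z
        shortcut : w ≡ _ ⊎ Adj G w _ → Adj G _ _
        shortcut (inj₁ refl) = ⊥-elim (≺-irrefl refl w≺z)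
        shortcut (inj₂ wz)   = increasingPath-umbrella path y≺z wz

  module BiCompatible {_≺_ : Rel (Fin n) ℓ}
    (≺-isStrictTotalOrder : IsStrictTotalOrder _≡_ _≺_)
    (peo : PerfectEliminationOrder _≺_)
    (peo-reverse : PerfectEliminationOrder (flip _≺_)) where

    private
      module Up   = PerfectElimination ≺-isStrictTotalOrder peo
      module Down =
        PerfectElimination (Flip.isStrictTotalOrder ≺-isStrictTotalOrder) peo-reverse
    open IsStrictTotalOrder ≺-isStrictTotalOrder
      using () renaming (irrefl to ≺-irrefl; asym to ≺-asym)

    walk⇒monotonePath : ∀ {u} ws {w} → WalkFrom G u ws w →
      IncreasingPath _≺_ u w ⊎ IncreasingPath (flip _≺_) u w
    walk⇒monotonePath []       refl          = inj₁ []
    walk⇒monotonePath (x ∷ ws) (ux , walk) with walk⇒monotonePath ws walk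
    ... | inj₁ up   = Up.increasingPath-prepend ux up
    ... | inj₂ down = swap (Down.increasingPath-prepend ux down)

    umbrella : Connected G → ∀ {x y z} → x ≺ y → y ≺ z → Adj G x z → Adj G y z
    umbrella connected {x} {y} x≺y y≺z xz with connected x y
    ... | ws , walk with walk⇒monotonePath ws walk
    ...   | inj₁ up   = Up.increasingPath-umbrella up y≺z xz
    ...   | inj₂ down with Down.increasingPath⇒≡⊎≺ down
    ...     | inj₁ refl = ⊥-elim (≺-irrefl refl x≺y)
    ...     | inj₂ y≺x  = ⊥-elim (≺-asym x≺y y≺x)

    N[]-umbrella : Connected G → ∀ {x y z} → x ≡ y ⊎ x ≺ y → y ≡ z ⊎ y ≺ z →
      N[_] G x z → N[_] G y z
    N[]-umbrella _         (inj₁ refl) _           xz          = xz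
    N[]-umbrella _         (inj₂ _)    (inj₁ refl) _           = inj₁ refl
    N[]-umbrella _         (inj₂ x≺y)  (inj₂ y≺x)  (inj₁ refl) = ⊥-elim (≺-asym x≺y y≺x)
    N[]-umbrella connected (inj₂ x≺y)  (inj₂ y≺z)  (inj₂ xz)   = inj₂ (umbrella connected x≺y y≺z xz)

module PositionOrder (σ : Fin n ↔ Fin n) where

  open Inverse σ using (to; from; strictlyInverseˡ)

  _≺_ : Rel (Fin n) 0ℓ
  x ≺ y = from x < from y

  from-injective : ∀ {x y} → from x ≡ from y → x ≡ y
  from-injective {x} {y} eq = begin
    x           ≡⟨ strictlyInverseˡ x ⟨
    to (from x) ≡⟨ cong to eq ⟩
    to (from y) ≡⟨ strictlyInverseˡ y ⟩
    y           ∎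
    where open ≡-Reasoning

  ≺-isStrictTotalOrder : IsStrictTotalOrder _≡_ _≺_
  ≺-isStrictTotalOrder = record
    { isStrictPartialOrder = record
      { isEquivalence = isEquivalence
      ; irrefl        = λ { refl → <-irrefl refl }
      ; trans         = <-trans
      ; <-resp-≈      = resp₂ _≺_
      }
    ; compare = compare
    }
    where
      compare : Trichotomous _≡_ _≺_
      compare x y with <-cmp (from x) (from y)
      ... | tri< lt ne gt = tri< lt (ne ∘ cong from) gt
      ... | tri≈ lt eq gt = tri≈ lt (from-injective eq) gt
      ... | tri> lt ne gt = tri> lt (ne ∘ cong from) gt

  ≤⇒≡⊎≺ : ∀ {x y} → from x ≤ from y → x ≡ y ⊎ x ≺ y
  ≤⇒≡⊎≺ le with m≤n⇒m<n∨m≡n le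
  ... | inj₁ lt = inj₂ lt
  ... | inj₂ eq = inj₁ (from-injective (toℕ-injective eq))

  module _ (G : Graph n) (bco : BCO G σ) where

    suffixSimplicial : ∀ x → SimplicialIn G (Suffix G σ (from x)) x
    suffixSimplicial x = subst (SimplicialIn G _) (strictlyInverseˡ x) (proj₂ (bco (from x)))

    prefixSimplicial : ∀ x → SimplicialIn G (Prefix G σ (from x)) x
    prefixSimplicial x = subst (SimplicialIn G _) (strictlyInverseˡ x) (proj₁ (bco (from x)))

    bco⇒peo : PerfectEliminationOrder G _≺_
    bco⇒peo x≺a x≺b xa xb = suffixSimplicial _ _ _ (<⇒≤ x≺a) (<⇒≤ x≺b) (inj₂ xa) (inj₂ xb)

    bco⇒peo-reverse : PerfectEliminationOrder G (flip _≺_)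
    bco⇒peo-reverse a≺x b≺x xa xb = prefixSimplicial _ _ _ (<⇒≤ a≺x) (<⇒≤ b≺x) (inj₂ xa) (inj₂ xb)

mainTheorem3 : ∀ {n} (G : Graph n) → Connected G → ProperInterval G →
    (σ : Fin n ↔ Fin n) → BCO G σ →
    (∀ i k → k ≤ i → ∀ w → N[_] G (Inverse.to σ k) w → Suffix G σ i w →
       NG_[_] G σ i (Inverse.to σ i) w)
    ×
    (∀ i k → NG_[_] G σ i (Inverse.to σ i) (Inverse.to σ k) →
       ∀ w → NG_[_] G σ i (Inverse.to σ i) w → NG_[_] G σ i (Inverse.to σ k) w)
mainTheorem3 G connected _ σ bco = partA , partB
  where
    open Inverse σ using (to; from; strictlyInverseʳ)
    open PositionOrder σ
    open BiCompatible G ≺-isStrictTotalOrder (bco⇒peo G bco) (bco⇒peo-reverse G bco)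

    partA : ∀ i k → k ≤ i → ∀ w → N[_] G (to k) w → Suffix G σ i w → NG_[_] G σ i (to i) w
    partA i k k≤i w k-w i≤w = i≤w , N[]-umbrella connected (≤⇒≡⊎≺ k≤i′) (≤⇒≡⊎≺ i≤w′) k-w
      where
        k≤i′ : from (to k) ≤ from (to i)
        k≤i′ = subst₂ _≤_ (sym (strictlyInverseʳ k)) (sym (strictlyInverseʳ i)) k≤i
        i≤w′ : from (to i) ≤ from w
        i≤w′ = subst (_≤ from w) (sym (strictlyInverseʳ i)) i≤w

    partB : ∀ i k → NG_[_] G σ i (to i) (to k) →
      ∀ w → NG_[_] G σ i (to i) w → NG_[_] G σ i (to k) w
    partB i k (k∈Gᵢ , i-k) w (w∈Gᵢ , i-w) =
      w∈Gᵢ , simplicial⇒N[]-⊆ G (proj₂ (bco i)) k∈Gᵢ w∈Gᵢ i-k i-w
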